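{- Let $G$ be a finite connected $4$-valent vertex-transitive graph that is not edge-transitive, and assume all edges of $G$ have type $2$. Then $\operatorname{Aut}G$ has exactly two orbits on edges; let $G_1$ and $G_2$ be the spanning subgraphs formed by the edges of these two orbits respectively (each is a disjoint union of cycles). Let $V'$ be a set of vertices of $G$ and let $C$ be a cycle of $G_1$ which is disjoint from $V'$ and contains a vertex $v$ adjacent in $G$ to some vertex of $V'$. Then there exist a cycle $D$ of $G_1$ disjoint from $V'$ (possibly $D=C$) and a partial $2$-colouring $\tilde c$ of $G$ with domain $V(C)\cup V(D)$ such that \begin{itemize} \item each of $C$ and $D$ contains either $1$ or $2$ black vertices under $\tilde c$, and \item if $\gamma\in\operatorname{Aut}G$ fixes every vertex of $V'$ and preserves some extension of $\tilde c$, then $\gamma$ fixes every vertex of $V'\cup V(C)\cup V(D)$. \end{itemize}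
   Context: Let $A=\operatorname{Aut}G$; for a vertex $w$, $A_w$ is its stabiliser acting on $N(w)$. The type of an edge $uw$ is the size of the orbit of $u$ under $A_w$ acting on $N(w)$. A partial $2$-colouring with domain $\tilde V\subseteq V(G)$ is a map $\tilde c:\tilde V\to\{\text{black},\text{white}\}$; an extension of $\tilde c$ is a colouring $c:V(G)\to\{\text{black},\text{white}\}$ agreeing with $\tilde c$ on $\tilde V$. An automorphism $\gamma$ preserves $c$ if $c(\gamma(x))=c(x)$ for all vertices $x$. -}

module Defs where

open import Data.Nat using (ℕ; zero; suc; _+_; _%_)
open import Data.Bool using (Bool; true; false; if_then_else_)
open import Data.Maybe using (Maybe; just; nothing)
open import Data.Fin using (Fin; toℕ)
open import Data.Fin.Subset using (Subset; _∈_; _∉_)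
open import Data.Product using (Σ; ∃; ∃-syntax; _×_; _,_)
open import Data.Sum using (_⊎_)
open import Relation.Nullary using (¬_)
open import Relation.Binary.PropositionalEquality using (_≡_; _≢_)
open import Relation.Binary.Construct.Closure.ReflexiveTransitive using (Star)

count : (m : ℕ) → (Fin m → Bool) → ℕ
count zero f = 0
count (suc m) f = (if f Fin.zero then 1 else 0) + count m (λ i → f (Fin.suc i))

record Graph (n : ℕ) : Set where
  field
    adj     : Fin n → Fin n → Bool
    symm    : ∀ x y → adj x y ≡ adj y x
    irrefl  : ∀ x → adj x x ≡ false

module _ {n : ℕ} (G : Graph n) where
  open Graph G

  Adj : Fin n → Fin n → Set
  Adj x y = adj x y ≡ true

  record Aut : Set where
    field
      fun   : Fin n → Fin n
      inv   : Fin n → Fin n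
      linv  : ∀ x → inv (fun x) ≡ x
      rinv  : ∀ x → fun (inv x) ≡ x
      pres  : ∀ x y → adj (fun x) (fun y) ≡ adj x y
  open Aut public

  FourValent : Set
  FourValent = ∀ v → count n (adj v) ≡ 4

  Connected : Set
  Connected = ∀ u v → Star Adj u v

  VertexTransitive : Set
  VertexTransitive = ∀ u v → Σ Aut λ γ → fun γ u ≡ v

  SameEdgeOrbit : Fin n → Fin n → Fin n → Fin n → Set
  SameEdgeOrbit u w x y =
    Σ Aut λ γ → (fun γ u ≡ x × fun γ w ≡ y) ⊎ (fun γ u ≡ y × fun γ w ≡ x)

  EdgeTransitive : Set
  EdgeTransitive = ∀ u w x y → Adj u w → Adj x y → SameEdgeOrbit u w x y

  InStabOrbit : (w u x : Fin n) → Set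
  InStabOrbit w u x = Σ Aut λ γ → fun γ w ≡ w × fun γ u ≡ x

  -- the type of the edge uw is 2: the A_w-orbit of u has exactly two elements
  EdgeType2 : (u w : Fin n) → Set
  EdgeType2 u w =
    ∃[ x₁ ] ∃[ x₂ ] (x₁ ≢ x₂ × InStabOrbit w u x₁ × InStabOrbit w u x₂ ×
                      (∀ x → InStabOrbit w u x → x ≡ x₁ ⊎ x ≡ x₂))

  AllEdgesType2 : Set
  AllEdgesType2 = ∀ u w → Adj u w → EdgeType2 u w

  ExactlyTwoEdgeOrbits : Set
  ExactlyTwoEdgeOrbits =
    ∃[ u₁ ] ∃[ w₁ ] ∃[ u₂ ] ∃[ w₂ ]
      (Adj u₁ w₁ × Adj u₂ w₂ × ¬ SameEdgeOrbit u₁ w₁ u₂ w₂ ×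
       (∀ x y → Adj x y → SameEdgeOrbit u₁ w₁ x y ⊎ SameEdgeOrbit u₂ w₂ x y))

  OrbitEdge : (u₀ w₀ : Fin n) → Fin n → Fin n → Set
  OrbitEdge u₀ w₀ x y = Adj x y × SameEdgeOrbit u₀ w₀ x y

-- A cycle in a graph with edge relation E on Fin n: a cyclic sequence
-- c 0, c 1, ..., c (k+2) of distinct vertices (length k+3 ≥ 3), consecutive
-- ones (indices mod the length) being E-adjacent.
record Cycle {n : ℕ} (E : Fin n → Fin n → Set) : Set where
  field
    len-3 : ℕ
    vtx   : Fin (suc (suc (suc len-3))) → Fin n
    inj   : ∀ i j → vtx i ≡ vtx j → i ≡ j
    edges : ∀ i j → toℕ j ≡ suc (toℕ i) % suc (suc (suc len-3)) →
            E (vtx i) (vtx j)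

  Len : ℕ
  Len = suc (suc (suc len-3))

  OnCycle : Fin n → Set
  OnCycle x = ∃[ i ] vtx i ≡ x

  DisjointFrom : Subset n → Set
  DisjointFrom V = ∀ i → vtx i ∉ V

isBlack : Maybe Bool → Bool
isBlack (just true) = true
isBlack _           = false

module _ {n : ℕ} {E : Fin n → Fin n → Set} where
  open Cycle

  -- number of vertices of the cycle that are black under a partial colouring
  -- (black = true; uncoloured = nothing)
  blackCount : (C : Cycle E) → (Fin n → Maybe Bool) → ℕ
  blackCount C ct = count (Len C) (λ i → isBlack (ct (vtx C i)))

Extends : {n : ℕ} → (Fin n → Bool) → (Fin n → Maybe Bool) → Set
Extends c ct = ∀ x b → ct x ≡ just b → c x ≡ b

module Submission where

open import Defs
open import Data.Nat using (ℕ; zero; suc; _+_; _∸_; _*_; _%_; _<_; s≤s; z≤n; NonZero)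
open import Data.Nat.Properties using (suc-injective; ≤-refl; +-identityʳ; +-suc; +-assoc; +-comm; +-cancelˡ-≡; m+[n∸m]≡n; <⇒≤)
open import Data.Nat.DivMod using (_/_; m%n<n; m<n⇒m%n≡m; [m+n]%n≡m%n; %-distribˡ-+; m%n%n≡m%n; m≡m%n+[m/n]*n)
open import Data.Nat.Divisibility using (_∣_; divides; >⇒∤)
open import Data.Bool using (Bool; true; false; _∧_; not)
open import Data.Bool.Properties using (∧-identityʳ)
open import Data.Maybe using (Maybe; just; nothing)
open import Data.Fin using (Fin; toℕ; fromℕ<)
open import Data.Fin.Properties using (_≟_; any?; toℕ-injective; toℕ-fromℕ<; toℕ<n)
open import Data.Fin.Subset using (Subset; _∈_)
open import Data.Fin.Subset.Properties using (_∈?_)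
open import Data.Product using (Σ; ∃-syntax; _×_; _,_; proj₁; proj₂)
open import Data.Sum using (_⊎_; inj₁; inj₂)
open import Data.Empty using (⊥-elim)
open import Relation.Nullary using (¬_; Dec; yes; no; does)
open import Relation.Nullary.Decidable using (dec-true; dec-false; _⊎-dec_)
open import Relation.Binary.PropositionalEquality

-- Counting the four neighbours of a
-- vertex w, and using that every stabiliser orbit on N(w) has size 2, splits
-- N(w) into two pairs, each inside one edge orbit; the two orbits differ,
-- as otherwise vertex-transitivity would make G edge-transitive.  This gives
-- the two edge orbits and shows that every orbit graph G₁ is 2-regular.
--
-- A cycle meeting
-- another lies on it, and an injective edge-preserving map fixing a vertex
-- of a cycle and preserving a colouring that distinguishes its two cycle
-- neighbours fixes both, hence, step by step, the whole cycle.
--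
-- Let x ∈ V' be adjacent to v on C and
-- let v' be the other neighbour of x in the orbit graph of xv, so that an
-- automorphism fixing x fixes or swaps v and v'.  Colour v and a C-neighbour
-- w ≠ v' of v black.  If v' ∈ C take D = C.  Otherwise pick α with α(v) = v'.
-- If α(C) meets V', again take D = C: an automorphism γ fixing V' with
-- γ(v) = v' would make α(C) part of γ(C), so γ(C), and hence C, would meet
-- V'.  Otherwise take D = α(C), disjoint from C, with α(w) its only black
-- vertex.

does-true : ∀ {A : Set} (a? : Dec A) → does a? ≡ true → A
does-true (yes a) _ = a
does-true (no _) ()

isBlack-just : ∀ b → isBlack (just b) ≡ b
isBlack-just true  = refl
isBlack-just false = refl

infixl 20 _without_
_without_ : ∀ {m} → (Fin m → Bool) → Fin m → Fin m → Bool
(f without a) y = f y ∧ not (does (y ≟ a))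

without-true : ∀ {m} (f : Fin m → Bool) {a y} → f y ≡ true → y ≢ a → (f without a) y ≡ true
without-true f {a} {y} fy y≢a rewrite dec-false (y ≟ a) y≢a = trans (∧-identityʳ (f y)) fy

without-true⁻ : ∀ {m} (f : Fin m → Bool) {a y} → (f without a) y ≡ true → f y ≡ true × y ≢ a
without-true⁻ f {a} {y} e with f y | y ≟ a
... | true  | no y≢a = refl , y≢a
without-true⁻ f () | true  | yes _
without-true⁻ f () | false | _

count-cong : ∀ m {f g : Fin m → Bool} → (∀ i → f i ≡ g i) → count m f ≡ count m g
count-cong zero    e = refl
count-cong (suc m) e rewrite e Fin.zero = cong (_ +_) (count-cong m (λ i → e (Fin.suc i)))

count-without : ∀ m (f : Fin m → Bool) a → f a ≡ true → count m f ≡ suc (count m (f without a))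
count-without (suc m) f Fin.zero fa rewrite fa =
  cong suc (count-cong m (λ i → sym (∧-identityʳ (f (Fin.suc i)))))
count-without (suc m) f (Fin.suc a) fa with f Fin.zero
... | true  = cong suc (count-without m (λ i → f (Fin.suc i)) a fa)
... | false = count-without m (λ i → f (Fin.suc i)) a fa

remove-point : ∀ m {k} {f : Fin m → Bool} {a} → count m f ≡ suc k → f a ≡ true →
               count m (f without a) ≡ k
remove-point m {f = f} {a} e fa = suc-injective (trans (sym (count-without m f a fa)) e)

count-witness : ∀ m (f : Fin m → Bool) {k} → count m f ≡ suc k → ∃[ i ] f i ≡ true
count-witness (suc m) f e with f Fin.zero in fz
... | true  = Fin.zero , fz
... | false with count-witness m (λ i → f (Fin.suc i)) e
...   | i , fi = Fin.suc i , fi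

count-zero : ∀ m {f : Fin m → Bool} → count m f ≡ 0 → ∀ i → f i ≢ true
count-zero m {f} e i fi with trans (sym e) (count-without m f i fi)
... | ()

count-none : ∀ m (f : Fin m → Bool) → (∀ i → f i ≢ true) → count m f ≡ 0
count-none zero    f none = refl
count-none (suc m) f none with f Fin.zero in fz
... | true  = ⊥-elim (none Fin.zero fz)
... | false = count-none m (λ i → f (Fin.suc i)) (λ i → none (Fin.suc i))

count-one : ∀ m (f : Fin m → Bool) a → f a ≡ true → (∀ i → f i ≡ true → i ≡ a) → count m f ≡ 1
count-one m f a fa only = trans (count-without m f a fa) (cong suc (count-none m (f without a) gone))
  where
  gone : ∀ i → (f without a) i ≢ true
  gone i e with without-true⁻ f e
  ... | fi , i≢a = i≢a (only i fi)

count-two : ∀ m (f : Fin m → Bool) a b → f a ≡ true → f b ≡ true → a ≢ b →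
            (∀ i → f i ≡ true → i ≡ a ⊎ i ≡ b) → count m f ≡ 2
count-two m f a b fa fb a≢b only =
  trans (count-without m f a fa)
        (cong suc (count-one m (f without a) b (without-true f fb (λ e → a≢b (sym e))) rest))
  where
  rest : ∀ i → (f without a) i ≡ true → i ≡ b
  rest i e with without-true⁻ f e
  ... | fi , i≢a with only i fi
  ...   | inj₁ i≡a = ⊥-elim (i≢a i≡a)
  ...   | inj₂ i≡b = i≡b

third-point : ∀ m (f : Fin m → Bool) {a b} → count m f ≡ 4 → f a ≡ true → f b ≡ true → a ≢ b →
              ∃[ c ] (f c ≡ true × c ≢ a × c ≢ b)
third-point m f {a} {b} e fa fb a≢b
  with count-witness m _ (remove-point m (remove-point m e fa) (without-true f fb (λ b≡a → a≢b (sym b≡a))))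
... | c , fc with without-true⁻ (f without a) fc
...   | fc' , c≢b with without-true⁻ f fc'
...     | fc'' , c≢a = c , fc'' , c≢a , c≢b

four-points : ∀ m (f : Fin m → Bool) {a b c d} → count m f ≡ 4 →
              f a ≡ true → f b ≡ true → f c ≡ true → f d ≡ true →
              b ≢ a → c ≢ a → c ≢ b → d ≢ a → d ≢ b → d ≢ c →
              ∀ t → f t ≡ true → (t ≡ a ⊎ t ≡ b) ⊎ (t ≡ c ⊎ t ≡ d)
four-points m f {a} {b} {c} {d} e fa fb fc fd b≢a c≢a c≢b d≢a d≢b d≢c t ft
  with t ≟ a | t ≟ b | t ≟ c | t ≟ d
... | yes t≡a | _ | _ | _ = inj₁ (inj₁ t≡a)
... | no _ | yes t≡b | _ | _ = inj₁ (inj₂ t≡b)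
... | no _ | no _ | yes t≡c | _ = inj₂ (inj₁ t≡c)
... | no _ | no _ | no _ | yes t≡d = inj₂ (inj₂ t≡d)
... | no t≢a | no t≢b | no t≢c | no t≢d = ⊥-elim (count-zero m none t
      (without-true f₃ (without-true f₂ (without-true f₁ (without-true f ft t≢a) t≢b) t≢c) t≢d))
  where
  f₁ f₂ f₃ : Fin m → Bool
  f₁ = f without a
  f₂ = f₁ without b
  f₃ = f₂ without c
  none : count m (f₃ without d) ≡ 0
  none = remove-point m (remove-point m (remove-point m (remove-point m e fa)
           (without-true f fb b≢a))
           (without-true f₁ (without-true f fc c≢a) c≢b))
           (without-true f₂ (without-true f₁ (without-true f fd d≢a) d≢b) d≢c)

-- An injective self-map of Fin n preserving a relation E; automorphisms of
-- G act in this way on each orbit graph.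
record Embedding {n : ℕ} (E : Fin n → Fin n → Set) : Set where
  field
    map       : Fin n → Fin n
    injective : ∀ {a b} → map a ≡ map b → a ≡ b
    preserves : ∀ {a b} → E a b → E (map a) (map b)
open Embedding

module Automorphisms {n : ℕ} (G : Graph n) where
  open Graph G

  idᴬ : Aut G
  idᴬ = record { fun = λ y → y ; inv = λ y → y ; linv = λ _ → refl ; rinv = λ _ → refl
               ; pres = λ _ _ → refl }

  infixr 9 _∘ᴬ_
  infix 10 _⁻¹ᴬ

  _∘ᴬ_ : Aut G → Aut G → Aut G
  g ∘ᴬ h = record
    { fun  = λ y → fun g (fun h y)
    ; inv  = λ y → inv h (inv g y)
    ; linv = λ y → trans (cong (inv h) (linv g (fun h y))) (linv h y)
    ; rinv = λ y → trans (cong (fun g) (rinv h (inv g y))) (rinv g y)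
    ; pres = λ a b → trans (pres g (fun h a) (fun h b)) (pres h a b) }

  _⁻¹ᴬ : Aut G → Aut G
  g ⁻¹ᴬ = record
    { fun = inv g ; inv = fun g ; linv = rinv g ; rinv = linv g
    ; pres = λ a b → trans (sym (pres g (inv g a) (inv g b))) (cong₂ adj (rinv g a) (rinv g b)) }

  fun-injective : ∀ (g : Aut G) {a b} → fun g a ≡ fun g b → a ≡ b
  fun-injective g {a} {b} e = trans (sym (linv g a)) (trans (cong (inv g) e) (linv g b))

  fun-inverse : ∀ (g : Aut G) {a b} → fun g a ≡ b → fun (g ⁻¹ᴬ) b ≡ a
  fun-inverse g {a} refl = linv g a

  adj-sym : ∀ {a b} → Adj G a b → Adj G b a
  adj-sym {a} {b} e = trans (symm b a) e

  adj-image : ∀ (g : Aut G) {a b} → Adj G a b → Adj G (fun g a) (fun g b)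
  adj-image g {a} {b} e = trans (pres g a b) e

  Same : Fin n → Fin n → Fin n → Fin n → Set
  Same = SameEdgeOrbit G

  same-refl : ∀ u w → Same u w u w
  same-refl u w = idᴬ , inj₁ (refl , refl)

  same-sym : ∀ {u w x y} → Same u w x y → Same x y u w
  same-sym (g , inj₁ (gu , gw)) = g ⁻¹ᴬ , inj₁ (fun-inverse g gu , fun-inverse g gw)
  same-sym (g , inj₂ (gu , gw)) = g ⁻¹ᴬ , inj₂ (fun-inverse g gw , fun-inverse g gu)

  same-flip : ∀ {u w x y} → Same u w x y → Same u w y x
  same-flip (g , inj₁ e) = g , inj₂ e
  same-flip (g , inj₂ e) = g , inj₁ e

  same-trans : ∀ {u w x y a b} → Same u w x y → Same x y a b → Same u w a b
  same-trans (g , inj₁ (gu , gw)) (h , inj₁ (hx , hy)) = h ∘ᴬ g , inj₁ (trans (cong (fun h) gu) hx , trans (cong (fun h) gw) hy)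
  same-trans (g , inj₁ (gu , gw)) (h , inj₂ (hx , hy)) = h ∘ᴬ g , inj₂ (trans (cong (fun h) gu) hx , trans (cong (fun h) gw) hy)
  same-trans (g , inj₂ (gu , gw)) (h , inj₁ (hx , hy)) = h ∘ᴬ g , inj₂ (trans (cong (fun h) gu) hy , trans (cong (fun h) gw) hx)
  same-trans (g , inj₂ (gu , gw)) (h , inj₂ (hx , hy)) = h ∘ᴬ g , inj₁ (trans (cong (fun h) gu) hy , trans (cong (fun h) gw) hx)

  same-image : ∀ (g : Aut G) u w → Same u w (fun g u) (fun g w)
  same-image g u w = g , inj₁ (refl , refl)

  orbitEdge-sym : ∀ {u₀ w₀ a b} → OrbitEdge G u₀ w₀ a b → OrbitEdge G u₀ w₀ b a
  orbitEdge-sym (e , s) = adj-sym e , same-flip s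

  ⟨_⟩ : ∀ {u₀ w₀} → Aut G → Embedding (OrbitEdge G u₀ w₀)
  ⟨ g ⟩ = record
    { map       = fun g
    ; injective = fun-injective g
    ; preserves = λ { {a} {b} (e , s) → adj-image g e , same-trans s (same-image g a b) } }

  stab-adj : ∀ {w a x} → Adj G w a → InStabOrbit G w a x → Adj G w x
  stab-adj e (γ , γw , γa) = subst₂ (Adj G) γw γa (adj-image γ e)

  stab-same : ∀ {w a x} → InStabOrbit G w a x → Same w a w x
  stab-same (γ , γw , γa) = γ , inj₁ (γw , γa)

  stab-meet : ∀ {w a b x} → InStabOrbit G w a x → InStabOrbit G w b x → InStabOrbit G w a b
  stab-meet (γ , γw , γa) (δ , δw , δb) =
    δ ⁻¹ᴬ ∘ᴬ γ , trans (cong (inv δ) γw) (fun-inverse δ δw) , trans (cong (inv δ) γa) (fun-inverse δ δb)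

record TwoNeighbours {n : ℕ} (E : Fin n → Fin n → Set) (w : Fin n) : Set where
  constructor two-neighbours
  field
    p q  : Fin n
    p≢q  : p ≢ q
    w~p  : E w p
    w~q  : E w q
    only : ∀ s → E w s → s ≡ p ⊎ s ≡ q

TwoRegular : ∀ {n} → (Fin n → Fin n → Set) → Set
TwoRegular E = ∀ w → TwoNeighbours E w

module _ {n : ℕ} {E : Fin n → Fin n → Set} {w : Fin n} where

  one-of : TwoNeighbours E w → ∀ {a b c} → E w a → E w b → a ≢ b → E w c → c ≡ a ⊎ c ≡ b
  one-of (two-neighbours _ _ _ _ _ only) {a} {b} {c} ea eb a≢b ec with only a ea | only b eb | only c ec
  ... | inj₁ refl | inj₁ refl | _         = ⊥-elim (a≢b refl)
  ... | inj₂ refl | inj₂ refl | _         = ⊥-elim (a≢b refl)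
  ... | inj₁ refl | inj₂ refl | inj₁ refl = inj₁ refl
  ... | inj₁ refl | inj₂ refl | inj₂ refl = inj₂ refl
  ... | inj₂ refl | inj₁ refl | inj₁ refl = inj₂ refl
  ... | inj₂ refl | inj₁ refl | inj₂ refl = inj₁ refl

  other-neighbour : TwoNeighbours E w → ∀ {a} → E w a → ∃[ a' ] (a' ≢ a × E w a')
  other-neighbour (two-neighbours p q p≢q ep eq only) {a} ea with only a ea
  ... | inj₁ refl = q , (λ q≡p → p≢q (sym q≡p)) , eq
  ... | inj₂ refl = p , p≢q , ep

  same-other : TwoNeighbours E w → ∀ {r a b} → E w r → E w a → E w b → a ≢ r → b ≢ r → a ≡ b
  same-other N er ea eb a≢r b≢r with one-of N eb er b≢r ea
  ... | inj₁ a≡b = a≡b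
  ... | inj₂ a≡r = ⊥-elim (a≢r a≡r)

  neighbour-image : TwoNeighbours E w → (h : Embedding E) → map h w ≡ w →
                    ∀ {a b y} → E w a → E w b → a ≢ b → E w y → map h y ≡ a ⊎ map h y ≡ b
  neighbour-image N h hw {y = y} ea eb a≢b ey =
    one-of N ea eb a≢b (subst (λ z → E z (map h y)) hw (preserves h ey))

  fix-or-swap : TwoNeighbours E w → (h : Embedding E) → map h w ≡ w →
                ∀ {a b} → E w a → E w b → a ≢ b →
                (map h a ≡ a × map h b ≡ b) ⊎ (map h a ≡ b × map h b ≡ a)
  fix-or-swap N h hw ea eb a≢b
    with neighbour-image N h hw ea eb a≢b ea | neighbour-image N h hw ea eb a≢b eb
  ... | inj₁ ha | inj₁ hb = ⊥-elim (a≢b (injective h (trans ha (sym hb))))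
  ... | inj₁ ha | inj₂ hb = inj₁ (ha , hb)
  ... | inj₂ ha | inj₁ hb = inj₂ (ha , hb)
  ... | inj₂ ha | inj₂ hb = ⊥-elim (a≢b (injective h (trans ha (sym hb))))

colour-breaks-swap : ∀ {n} (h : Fin n → Fin n) (c : Fin n → Bool) {a b} →
                     (∀ y → c (h y) ≡ c y) → c a ≢ c b →
                     (h a ≡ a × h b ≡ b) ⊎ (h a ≡ b × h b ≡ a) → h a ≡ a × h b ≡ b
colour-breaks-swap h c pres ca≢cb (inj₁ fixed)    = fixed
colour-breaks-swap h c {a} pres ca≢cb (inj₂ (ha , _)) = ⊥-elim (ca≢cb (trans (sym (pres a)) (cong c ha)))

module LocalStructure {n : ℕ} (G : Graph n) (fv : FourValent G) (vt : VertexTransitive G)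
                      (net : ¬ EdgeTransitive G) (t2 : AllEdgesType2 G) where
  open Graph G
  open Automorphisms G

  move-edge : ∀ {p q} w → Adj G p q → ∃[ t ] (Adj G w t × Same p q w t)
  move-edge {p} {q} w e with vt p w
  ... | β , βp≡w = fun β q , subst (λ z → Adj G z (fun β q)) βp≡w (adj-image β e)
                           , subst (λ z → Same p q z (fun β q)) βp≡w (same-image β p q)

  one-orbit-at⇒edge-transitive : ∀ w a → (∀ t → Adj G w t → Same w a w t) → EdgeTransitive G
  one-orbit-at⇒edge-transitive w a one u u' x y uu' xy with move-edge w uu' | move-edge w xy
  ... | t , wt , s | t' , wt' , s' =
    same-trans (same-trans s (same-sym (one t wt))) (same-trans (one t' wt') (same-sym s'))

  record Split (w : Fin n) : Set where
    field
      x₁ x₂ y₁ y₂   : Fin n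
      x₁≢x₂         : x₁ ≢ x₂
      y₁≢y₂         : y₁ ≢ y₂
      w~x₁          : Adj G w x₁
      w~x₂          : Adj G w x₂
      w~y₁          : Adj G w y₁
      w~y₂          : Adj G w y₂
      x-orbit       : Same w x₁ w x₂
      y-orbit       : Same w y₁ w y₂
      covers        : ∀ t → Adj G w t → (t ≡ x₁ ⊎ t ≡ x₂) ⊎ (t ≡ y₁ ⊎ t ≡ y₂)
      orbits-differ : ¬ Same w x₁ w y₁

  -- The pairs are the A_w-orbits of a neighbour a and of a neighbour b
  -- outside the orbit of a; a fifth neighbour would exceed the valency.
  split : ∀ w → Split w
  split w with count-witness n (adj w) (fv w)
  ... | a , w~a with t2 a w (adj-sym w~a)
  ... | x₁ , x₂ , x₁≢x₂ , ox₁ , ox₂ , a-orbit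
    with third-point n (adj w) (fv w) (stab-adj w~a ox₁) (stab-adj w~a ox₂) x₁≢x₂
  ... | b , w~b , b≢x₁ , b≢x₂ with t2 b w (adj-sym w~b)
  ... | y₁ , y₂ , y₁≢y₂ , oy₁ , oy₂ , _ = record
    { x₁ = x₁ ; x₂ = x₂ ; y₁ = y₁ ; y₂ = y₂ ; x₁≢x₂ = x₁≢x₂ ; y₁≢y₂ = y₁≢y₂
    ; w~x₁ = w~x₁ ; w~x₂ = w~x₂ ; w~y₁ = w~y₁ ; w~y₂ = w~y₂
    ; x-orbit = x-orbit ; y-orbit = y-orbit ; covers = covers ; orbits-differ = orbits-differ }
    where
    w~x₁ = stab-adj w~a ox₁
    w~x₂ = stab-adj w~a ox₂
    w~y₁ = stab-adj w~b oy₁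
    w~y₂ = stab-adj w~b oy₂
    x-orbit = same-trans (same-sym (stab-same ox₁)) (stab-same ox₂)
    y-orbit = same-trans (same-sym (stab-same oy₁)) (stab-same oy₂)

    -- the A_w-orbits of a and b are disjoint, since b is not in that of a
    apart : ∀ {y x} → InStabOrbit G w b y → InStabOrbit G w a x → y ≢ x
    apart oy ox refl with a-orbit _ (stab-meet ox oy)
    ... | inj₁ b≡x₁ = b≢x₁ b≡x₁
    ... | inj₂ b≡x₂ = b≢x₂ b≡x₂

    covers : ∀ t → Adj G w t → (t ≡ x₁ ⊎ t ≡ x₂) ⊎ (t ≡ y₁ ⊎ t ≡ y₂)
    covers = four-points n (adj w) (fv w) w~x₁ w~x₂ w~y₁ w~y₂ (λ e → x₁≢x₂ (sym e))
               (apart oy₁ ox₁) (apart oy₁ ox₂) (apart oy₂ ox₁) (apart oy₂ ox₂) (λ e → y₁≢y₂ (sym e))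

    orbits-differ : ¬ Same w x₁ w y₁
    orbits-differ s = net (one-orbit-at⇒edge-transitive w x₁ one)
      where
      one : ∀ t → Adj G w t → Same w x₁ w t
      one t wt with covers t wt
      ... | inj₁ (inj₁ refl) = same-refl w x₁
      ... | inj₁ (inj₂ refl) = x-orbit
      ... | inj₂ (inj₁ refl) = s
      ... | inj₂ (inj₂ refl) = same-trans s y-orbit

  module _ {w : Fin n} (S : Split w) where
    open Split S

    x-member : ∀ {t} → t ≡ x₁ ⊎ t ≡ x₂ → Same w x₁ w t
    x-member (inj₁ refl) = same-refl w x₁
    x-member (inj₂ refl) = x-orbit

    y-member : ∀ {t} → t ≡ y₁ ⊎ t ≡ y₂ → Same w y₁ w t
    y-member (inj₁ refl) = same-refl w y₁
    y-member (inj₂ refl) = y-orbit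

    x-class : ∀ s → Adj G w s → Same w x₁ w s → s ≡ x₁ ⊎ s ≡ x₂
    x-class s ws o with covers s ws
    ... | inj₁ s∈x = s∈x
    ... | inj₂ s∈y = ⊥-elim (orbits-differ (same-trans o (same-sym (y-member s∈y))))

    y-class : ∀ s → Adj G w s → Same w y₁ w s → s ≡ y₁ ⊎ s ≡ y₂
    y-class s ws o with covers s ws
    ... | inj₁ s∈x = ⊥-elim (orbits-differ (same-trans (x-member s∈x) (same-sym o)))
    ... | inj₂ s∈y = s∈y

  two-edge-orbits : Fin n → ExactlyTwoEdgeOrbits G
  two-edge-orbits w = w , x₁ , w , y₁ , w~x₁ , w~y₁ , orbits-differ , classify
    where
    S = split w
    open Split S
    classify : ∀ p q → Adj G p q → Same w x₁ p q ⊎ Same w y₁ p q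
    classify p q pq with move-edge w pq
    ... | t , wt , o with covers t wt
    ...   | inj₁ t∈x = inj₁ (same-trans (x-member S t∈x) (same-sym o))
    ...   | inj₂ t∈y = inj₂ (same-trans (y-member S t∈y) (same-sym o))

  class-neighbours : ∀ {u₀ w₀ w} p q → p ≢ q → Adj G w p → Adj G w q → Same w p w q →
                     (∀ s → Adj G w s → Same w p w s → s ≡ p ⊎ s ≡ q) → Same u₀ w₀ w p →
                     TwoNeighbours (OrbitEdge G u₀ w₀) w
  class-neighbours p q p≢q wp wq pq only o =
    two-neighbours p q p≢q (wp , o) (wq , same-trans o pq) λ s (ws , os) → only s ws (same-trans (same-sym o) os)

  orbit-graph-regular : ∀ {u₀ w₀} → Adj G u₀ w₀ → TwoRegular (OrbitEdge G u₀ w₀)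
  orbit-graph-regular {u₀} {w₀} u₀w₀ w with move-edge w (adj-sym u₀w₀)
  ... | t , wt , o = in-class (covers t wt)
    where
    S = split w
    open Split S
    ut : Same u₀ w₀ w t
    ut = same-sym (same-flip (same-sym o))
    in-class : (t ≡ x₁ ⊎ t ≡ x₂) ⊎ (t ≡ y₁ ⊎ t ≡ y₂) → TwoNeighbours (OrbitEdge G u₀ w₀) w
    in-class (inj₁ t∈x) = class-neighbours x₁ x₂ x₁≢x₂ w~x₁ w~x₂ x-orbit (x-class S)
                            (same-trans ut (same-sym (x-member S t∈x)))
    in-class (inj₂ t∈y) = class-neighbours y₁ y₂ y₁≢y₂ w~y₁ w~y₂ y-orbit (y-class S)
                            (same-trans ut (same-sym (y-member S t∈y)))

module CyclicIndex (k : ℕ) where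

  L : ℕ
  L = suc (suc (suc k))

  next : Fin L → Fin L
  next i = fromℕ< (m%n<n (suc (toℕ i)) L)

  next-toℕ : ∀ i → toℕ (next i) ≡ suc (toℕ i) % L
  next-toℕ i = toℕ-fromℕ< (m%n<n (suc (toℕ i)) L)

  step : ℕ → Fin L → Fin L
  step zero    i = i
  step (suc m) i = next (step m i)

  suc-mod : ∀ a → suc (a % L) % L ≡ suc a % L
  suc-mod a = begin
    (1 + a % L) % L           ≡⟨ %-distribˡ-+ 1 (a % L) L ⟩
    (1 % L + a % L % L) % L   ≡⟨ cong (λ r → (1 % L + r) % L) (m%n%n≡m%n a L) ⟩
    (1 % L + a % L) % L       ≡⟨ %-distribˡ-+ 1 a L ⟨
    (1 + a) % L               ∎
    where open ≡-Reasoning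

  step-toℕ : ∀ m i → toℕ (step m i) ≡ (toℕ i + m) % L
  step-toℕ zero i = begin
    toℕ i             ≡⟨ m<n⇒m%n≡m (toℕ<n i) ⟨
    toℕ i % L         ≡⟨ cong (_% L) (+-identityʳ (toℕ i)) ⟨
    (toℕ i + 0) % L   ∎
    where open ≡-Reasoning
  step-toℕ (suc m) i = begin
    toℕ (next (step m i))       ≡⟨ next-toℕ (step m i) ⟩
    suc (toℕ (step m i)) % L    ≡⟨ cong (λ r → suc r % L) (step-toℕ m i) ⟩
    suc ((toℕ i + m) % L) % L   ≡⟨ suc-mod (toℕ i + m) ⟩
    suc (toℕ i + m) % L         ≡⟨ cong (_% L) (+-suc (toℕ i) m) ⟨
    (toℕ i + suc m) % L         ∎
    where open ≡-Reasoning

  step-reaches : ∀ i j → ∃[ m ] step m i ≡ j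
  step-reaches i j = (L ∸ toℕ i) + toℕ j , toℕ-injective (begin
    toℕ (step ((L ∸ toℕ i) + toℕ j) i)      ≡⟨ step-toℕ _ i ⟩
    (toℕ i + ((L ∸ toℕ i) + toℕ j)) % L     ≡⟨ cong (_% L) (+-assoc (toℕ i) _ (toℕ j)) ⟨
    (toℕ i + (L ∸ toℕ i) + toℕ j) % L       ≡⟨ cong (λ r → (r + toℕ j) % L) (m+[n∸m]≡n (<⇒≤ (toℕ<n i))) ⟩
    (L + toℕ j) % L                          ≡⟨ cong (_% L) (+-comm L (toℕ j)) ⟩
    (toℕ j + L) % L                          ≡⟨ [m+n]%n≡m%n (toℕ j) L ⟩
    toℕ j % L                                ≡⟨ m<n⇒m%n≡m (toℕ<n j) ⟩
    toℕ j                                    ∎)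
    where open ≡-Reasoning

  step-returns : ∀ m i → step m i ≡ i → L ∣ m
  step-returns m i e = divides ((toℕ i + m) / L) (+-cancelˡ-≡ (toℕ i) m _ (begin
    toℕ i + m                                   ≡⟨ m≡m%n+[m/n]*n (toℕ i + m) L ⟩
    (toℕ i + m) % L + (toℕ i + m) / L * L       ≡⟨ cong (_+ (toℕ i + m) / L * L) (trans (sym (step-toℕ m i)) (cong toℕ e)) ⟩
    toℕ i + (toℕ i + m) / L * L                 ∎))
    where open ≡-Reasoning

  no-early-return : ∀ m i → .{{NonZero m}} → m < L → step m i ≢ i
  no-early-return m i m<L e = >⇒∤ m<L (step-returns m i e)

  prev : Fin L → Fin L
  prev = step (suc (suc k))

  next-prev : ∀ i → next (prev i) ≡ i
  next-prev i = toℕ-injective (begin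
    toℕ (step L i)    ≡⟨ step-toℕ L i ⟩
    (toℕ i + L) % L   ≡⟨ [m+n]%n≡m%n (toℕ i) L ⟩
    toℕ i % L         ≡⟨ m<n⇒m%n≡m (toℕ<n i) ⟩
    toℕ i             ∎)
    where open ≡-Reasoning

  -- since L ≥ 3, i, next i and prev i are distinct, and next (next i) ≠ i
  next-≢ : ∀ i → next i ≢ i
  next-≢ i = no-early-return 1 i (s≤s (s≤s z≤n))

  next²-≢ : ∀ i → next (next i) ≢ i
  next²-≢ i = no-early-return 2 i (s≤s (s≤s (s≤s z≤n)))

  prev-≢ : ∀ i → prev i ≢ i
  prev-≢ i = no-early-return (suc (suc k)) i ≤-refl

  next≢prev : ∀ i → next i ≢ prev i
  next≢prev i e = next²-≢ i (trans (cong next e) (next-prev i))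

image : ∀ {n} {E : Fin n → Fin n → Set} → Embedding E → Cycle E → Cycle E
image h C = record
  { len-3 = Cycle.len-3 C
  ; vtx   = λ i → map h (Cycle.vtx C i)
  ; inj   = λ i j e → Cycle.inj C i j (injective h e)
  ; edges = λ i j e → preserves h (Cycle.edges C i j e) }

module CycleFacts {n : ℕ} {E : Fin n → Fin n → Set} (E-sym : ∀ {a b} → E a b → E b a)
                  (regular : TwoRegular E) (C : Cycle E) where
  open Cycle C
  open CyclicIndex len-3 public

  on-cycle? : ∀ y → Dec (OnCycle y)
  on-cycle? y = any? (λ i → vtx i ≟ y)

  edge-next : ∀ i → E (vtx i) (vtx (next i))
  edge-next i = edges i (next i) (next-toℕ i)

  edge-prev : ∀ i → E (vtx i) (vtx (prev i))
  edge-prev i = E-sym (subst (λ j → E (vtx (prev i)) (vtx j)) (next-prev i) (edge-next (prev i)))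

  next≢prev-vtx : ∀ i → vtx (next i) ≢ vtx (prev i)
  next≢prev-vtx i e = next≢prev i (inj _ _ e)

  on-cycle-closed : ∀ {a b} → OnCycle a → E a b → OnCycle b
  on-cycle-closed {b = b} (i , refl) ab with one-of (regular (vtx i)) {c = b} (edge-next i) (edge-prev i) (next≢prev-vtx i) ab
  ... | inj₁ refl = next i , refl
  ... | inj₂ refl = prev i , refl

  absorbs : (K : Cycle E) → ∀ i → OnCycle (Cycle.vtx K i) → ∀ j → OnCycle (Cycle.vtx K j)
  absorbs K i Ki j = subst (λ l → OnCycle (Cycle.vtx K l)) (proj₂ reach) (walk (proj₁ reach))
    where
    module K = CyclicIndex (Cycle.len-3 K)
    reach : ∃[ m ] K.step m i ≡ j
    reach = K.step-reaches i j
    walk : ∀ m → OnCycle (Cycle.vtx K (K.step m i))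
    walk zero    = Ki
    walk (suc m) = on-cycle-closed (walk m) (Cycle.edges K _ _ (K.next-toℕ (K.step m i)))

  Fixes : Embedding E → Fin n → Set
  Fixes h y = map h y ≡ y

  fixes-next : (h : Embedding E) → ∀ p → Fixes h (vtx p) → Fixes h (vtx (next p)) →
               Fixes h (vtx (next (next p)))
  fixes-next h p ha hb =
    same-other (regular (vtx (next p))) (E-sym (edge-next p)) hc-adj (edge-next (next p)) hc≢a c≢a
    where
    c≢a : vtx (next (next p)) ≢ vtx p
    c≢a e = next²-≢ p (inj _ _ e)
    hc≢a : map h (vtx (next (next p))) ≢ vtx p
    hc≢a e = c≢a (injective h (trans e (sym ha)))
    hc-adj : E (vtx (next p)) (map h (vtx (next (next p))))
    hc-adj = subst (λ z → E z (map h (vtx (next (next p))))) hb (preserves h (edge-next (next p)))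

  rigid : (h : Embedding E) → ∀ i → Fixes h (vtx i) → Fixes h (vtx (next i)) → ∀ j → Fixes h (vtx j)
  rigid h i hi hn j with step-reaches i j
  ... | m , refl = proj₁ (pair m)
    where
    pair : ∀ m → Fixes h (vtx (step m i)) × Fixes h (vtx (step (suc m) i))
    pair zero    = hi , hn
    pair (suc m) with pair m
    ... | ha , hb = hb , fixes-next h (step m i) ha hb

  pin : (h : Embedding E) (c : Fin n → Bool) → (∀ y → c (map h y) ≡ c y) →
        ∀ i → Fixes h (vtx i) → c (vtx (next i)) ≢ c (vtx (prev i)) → ∀ j → Fixes h (vtx j)
  pin h c pres i hi differ = rigid h i hi (proj₁ (colour-breaks-swap (map h) c pres differ
    (fix-or-swap (regular (vtx i)) h hi (edge-next i) (edge-prev i) (next≢prev-vtx i))))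

  marked-neighbour : (c : Fin n → Bool) → ∀ {i j} → j ≡ next i ⊎ j ≡ prev i → c (vtx j) ≡ true →
                     (∀ m → c (vtx m) ≡ true → m ≡ i ⊎ m ≡ j) → c (vtx (next i)) ≢ c (vtx (prev i))
  marked-neighbour c {i} (inj₁ refl) cj only e with only (prev i) (trans (sym e) cj)
  ... | inj₁ p≡i = prev-≢ i p≡i
  ... | inj₂ p≡n = next≢prev i (sym p≡n)
  marked-neighbour c {i} (inj₂ refl) cj only e with only (next i) (trans e cj)
  ... | inj₁ n≡i = next-≢ i n≡i
  ... | inj₂ n≡p = next≢prev i n≡p

restrict : ∀ {n} {P : Fin n → Set} → (∀ y → Dec (P y)) → (Fin n → Bool) → Fin n → Maybe Bool
restrict P? b y with P? y
... | yes _ = just (b y)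
... | no _  = nothing

module _ {n : ℕ} {P : Fin n → Set} (P? : ∀ y → Dec (P y)) (b : Fin n → Bool) where

  restrict-inside : ∀ {y} → P y → restrict P? b y ≡ just (b y)
  restrict-inside {y} Py with P? y
  ... | yes _  = refl
  ... | no ¬Py = ⊥-elim (¬Py Py)

  restrict-domain : ∀ y → (restrict P? b y ≢ nothing → P y) × (P y → restrict P? b y ≢ nothing)
  restrict-domain y with P? y
  ... | yes Py  = (λ _ → Py) , λ _ ()
  ... | no ¬Py = (λ defined → ⊥-elim (defined refl)) , λ Py → ⊥-elim (¬Py Py)

  extension-inside : ∀ {c} → Extends c (restrict P? b) → ∀ {y} → P y → c y ≡ b y
  extension-inside ext {y} Py = ext y (b y) (restrict-inside Py)

  blackCount-inside : ∀ {E : Fin n → Fin n → Set} (K : Cycle E) → (∀ m → P (Cycle.vtx K m)) →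
                      blackCount K (restrict P? b) ≡ count (Cycle.Len K) (λ m → b (Cycle.vtx K m))
  blackCount-inside K inside = count-cong (Cycle.Len K) λ m →
    trans (cong isBlack (restrict-inside (inside m))) (isBlack-just _)

module _ {n : ℕ} (G : Graph n) {u₀ w₀ : Fin n} (V' : Subset n) where

  PinsDown : (Fin n → Maybe Bool) → (C D : Cycle (OrbitEdge G u₀ w₀)) → Set
  PinsDown ct C D =
    ∀ (γ : Aut G) → (∀ x → x ∈ V' → fun γ x ≡ x) →
    (Σ (Fin n → Bool) λ c → Extends c ct × (∀ x → c (fun {G = G} γ x) ≡ c x)) →
    ∀ x → (x ∈ V' ⊎ Cycle.OnCycle C x ⊎ Cycle.OnCycle D x) → fun γ x ≡ x

  Witness : Cycle (OrbitEdge G u₀ w₀) → Set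
  Witness C =
    Σ (Cycle (OrbitEdge G u₀ w₀)) λ D →
      Cycle.DisjointFrom D V' ×
      Σ (Fin n → Maybe Bool) λ ct →
        (∀ x → (ct x ≢ nothing → Cycle.OnCycle C x ⊎ Cycle.OnCycle D x) ×
               (Cycle.OnCycle C x ⊎ Cycle.OnCycle D x → ct x ≢ nothing)) ×
        (blackCount C ct ≡ 1 ⊎ blackCount C ct ≡ 2) ×
        (blackCount D ct ≡ 1 ⊎ blackCount D ct ≡ 2) ×
        PinsDown ct C D

module Construction {n : ℕ} (G : Graph n) (vt : VertexTransitive G)
    (regular : ∀ {a b} → Adj G a b → TwoRegular (OrbitEdge G a b))
    {u₀ w₀ : Fin n} (u₀w₀ : Adj G u₀ w₀) (V' : Subset n)
    (C : Cycle (OrbitEdge G u₀ w₀)) (C∩V'=∅ : Cycle.DisjointFrom C V')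
    (i₀ : Fin (Cycle.Len C)) (x : Fin n) (x∈V' : x ∈ V') (v~x : Adj G (Cycle.vtx C i₀) x) where
  open Automorphisms G
  open Cycle C using (vtx; inj; OnCycle)
  module CF = CycleFacts (orbitEdge-sym {u₀} {w₀}) (regular u₀w₀)
  open CF C

  v : Fin n
  v = vtx i₀

  x~v : OrbitEdge G x v x v
  x~v = adj-sym v~x , same-refl x v

  x-neighbours : TwoNeighbours (OrbitEdge G x v) x
  x-neighbours = regular (adj-sym v~x) x

  v' : Fin n
  v' = proj₁ (other-neighbour x-neighbours x~v)

  v'≢v : v' ≢ v
  v'≢v = proj₁ (proj₂ (other-neighbour x-neighbours x~v))

  v≢v' : v ≢ v'
  v≢v' e = v'≢v (sym e)

  x~v' : OrbitEdge G x v x v'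
  x~v' = proj₂ (proj₂ (other-neighbour x-neighbours x~v))

  fixes-v : ∀ (γ : Aut G) (c : Fin n → Bool) → fun γ x ≡ x → (∀ y → c (fun γ y) ≡ c y) →
            c v ≢ c v' → fun γ v ≡ v × fun γ v' ≡ v'
  fixes-v γ c γx pres differ =
    colour-breaks-swap (fun γ) c pres differ (fix-or-swap x-neighbours ⟨ γ ⟩ γx x~v x~v' v≢v')

  marked : ∃[ j ] ((j ≡ next i₀ ⊎ j ≡ prev i₀) × vtx j ≢ v')
  marked with vtx (next i₀) ≟ v'
  ... | no  n≢v' = next i₀ , inj₁ refl , n≢v'
  ... | yes n≡v' = prev i₀ , inj₂ refl , λ p≡v' → next≢prev-vtx i₀ (trans n≡v' (sym p≡v'))

  j : Fin (Cycle.Len C)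
  j = proj₁ marked

  j-adjacent : j ≡ next i₀ ⊎ j ≡ prev i₀
  j-adjacent = proj₁ (proj₂ marked)

  w : Fin n
  w = vtx j

  w≢v' : w ≢ v'
  w≢v' = proj₂ (proj₂ marked)

  j≢i₀ : j ≢ i₀
  j≢i₀ e with j-adjacent
  ... | inj₁ j≡n = next-≢ i₀ (trans (sym j≡n) e)
  ... | inj₂ j≡p = prev-≢ i₀ (trans (sym j≡p) e)

  Black : Fin n → Fin n → Set
  Black d y = y ≡ v ⊎ y ≡ w ⊎ y ≡ d

  black : Fin n → Fin n → Bool
  black d y = does (y ≟ v ⊎-dec (y ≟ w ⊎-dec y ≟ d))

  black-true : ∀ {d y} → Black d y → black d y ≡ true
  black-true {d} {y} = dec-true (y ≟ v ⊎-dec (y ≟ w ⊎-dec y ≟ d))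

  black-true⁻ : ∀ {d y} → black d y ≡ true → Black d y
  black-true⁻ {d} {y} = does-true (y ≟ v ⊎-dec (y ≟ w ⊎-dec y ≟ d))

  v'-white : ∀ {d} → v' ≢ d → black d v' ≢ true
  v'-white v'≢d b with black-true⁻ b
  ... | inj₁ v'≡v        = v'≢v v'≡v
  ... | inj₂ (inj₁ v'≡w) = w≢v' (sym v'≡w)
  ... | inj₂ (inj₂ v'≡d) = v'≢d v'≡d

  module Colouring (D : Cycle (OrbitEdge G u₀ w₀)) (d : Fin n) where
    InDomain : Fin n → Set
    InDomain y = OnCycle y ⊎ Cycle.OnCycle D y

    in-domain? : ∀ y → Dec (InDomain y)
    in-domain? y = on-cycle? y ⊎-dec CF.on-cycle? D y

    ct : Fin n → Maybe Bool
    ct = restrict in-domain? (black d)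

    domain : ∀ y → (ct y ≢ nothing → InDomain y) × (InDomain y → ct y ≢ nothing)
    domain = restrict-domain in-domain? (black d)

    colour : ∀ {c} → Extends c ct → ∀ {y} → InDomain y → c y ≡ black d y
    colour = extension-inside in-domain? (black d)

    v-v'-differ : ∀ {c} → Extends c ct → InDomain v' → v' ≢ d → c v ≢ c v'
    v-v'-differ ext v'∈ v'≢d e = v'-white v'≢d (begin
      black d v'  ≡⟨ colour ext v'∈ ⟨
      _           ≡⟨ e ⟨
      _           ≡⟨ colour ext (inj₁ (i₀ , refl)) ⟩
      black d v   ≡⟨ black-true (inj₁ refl) ⟩
      true        ∎)
      where open ≡-Reasoning

    module _ (d-on-C : OnCycle d → d ≡ v) where
      black-on-C : ∀ m → black d (vtx m) ≡ true → m ≡ i₀ ⊎ m ≡ j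
      black-on-C m b with black-true⁻ b
      ... | inj₁ e        = inj₁ (inj _ _ e)
      ... | inj₂ (inj₁ e) = inj₂ (inj _ _ e)
      ... | inj₂ (inj₂ e) = inj₁ (inj _ _ (trans e (d-on-C (m , e))))

      count-C : blackCount C ct ≡ 2
      count-C = trans (blackCount-inside in-domain? (black d) C (λ m → inj₁ (m , refl)))
                      (count-two _ _ i₀ j (black-true (inj₁ refl)) (black-true (inj₂ (inj₁ refl)))
                                 (λ e → j≢i₀ (sym e)) black-on-C)

      fixes-C : ∀ (γ : Aut G) {c} → Extends c ct → (∀ y → c (fun γ y) ≡ c y) →
                fun γ v ≡ v → ∀ m → fun γ (vtx m) ≡ vtx m
      fixes-C γ {c} ext pres γv = pin ⟨ γ ⟩ c pres i₀ γv (marked-neighbour c j-adjacent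
        (trans (colour ext (inj₁ (j , refl))) (black-true (inj₂ (inj₁ refl))))
        (λ m cm → black-on-C m (trans (sym (colour ext (inj₁ (m , refl)))) cm)))

  same-cycle : (∀ (γ : Aut G) c → (∀ y → y ∈ V' → fun γ y ≡ y) → Extends c (Colouring.ct C v) →
                 (∀ y → c (fun γ y) ≡ c y) → fun γ v ≡ v) →
               Witness G V' C
  same-cycle v-fixed = C , C∩V'=∅ , ct , domain , inj₂ (count-C d-on-C) , inj₂ (count-C d-on-C) , pinned
    where
    open Colouring C v
    d-on-C : OnCycle v → v ≡ v
    d-on-C _ = refl
    pinned : PinsDown G V' ct C C
    pinned γ fix (c , ext , pres) y (inj₁ y∈V') = fix y y∈V'
    pinned γ fix (c , ext , pres) y (inj₂ (inj₁ (m , refl))) =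
      fixes-C d-on-C γ ext pres (v-fixed γ c fix ext pres) m
    pinned γ fix (c , ext , pres) y (inj₂ (inj₂ (m , refl))) =
      fixes-C d-on-C γ ext pres (v-fixed γ c fix ext pres) m

  -- Case v' ∈ C: take D = C; v and v' get different colours.
  on-C : OnCycle v' → Witness G V' C
  on-C v'∈C = same-cycle λ γ c fix ext pres →
    proj₁ (fixes-v γ c (fix x x∈V') pres (Colouring.v-v'-differ C v ext (inj₁ v'∈C) v'≢v))

  -- Case α(v) = v' with α(C) meeting V': take D = C.  If γ fixing V' sent
  -- v to v', then α(C) would lie on γ(C), so γ(C) would meet V' = γ(V').
  meets : (α : Aut G) → fun α v ≡ v' → ∃[ m ] fun α (vtx m) ∈ V' → Witness G V' C
  meets α αv≡v' (m , αm∈V') = same-cycle v-fixed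
    where
    v-fixed : ∀ (γ : Aut G) c → (∀ y → y ∈ V' → fun γ y ≡ y) → Extends c (Colouring.ct C v) →
              (∀ y → c (fun γ y) ≡ c y) → fun γ v ≡ v
    v-fixed γ c fix ext pres with fix-or-swap x-neighbours ⟨ γ ⟩ (fix x x∈V') x~v x~v' v≢v'
    ... | inj₁ (γv≡v , _) = γv≡v
    ... | inj₂ (γv≡v' , _)
      with CF.absorbs (image ⟨ γ ⟩ C) (image ⟨ α ⟩ C) i₀ (i₀ , trans γv≡v' (sym αv≡v')) m
    ...   | k , γk≡αm = ⊥-elim (C∩V'=∅ k (subst (_∈ V') k≡αm αm∈V'))
      where
      k≡αm : fun α (vtx m) ≡ vtx k
      k≡αm = sym (fun-injective γ (trans γk≡αm (sym (fix _ αm∈V'))))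

  misses : (α : Aut G) → fun α v ≡ v' → ¬ OnCycle v' → Cycle.DisjointFrom (image ⟨ α ⟩ C) V' →
           Witness G V' C
  misses α αv≡v' v'∉C D∩V'=∅ =
    D , D∩V'=∅ , ct , domain , inj₂ (count-C d-on-C) , inj₁ count-D , pinned
    where
    D : Cycle (OrbitEdge G u₀ w₀)
    D = image ⟨ α ⟩ C
    module ᴰ = CF D
    d : Fin n
    d = fun α w
    open Colouring D d

    off-C : ∀ m → ¬ OnCycle (fun α (vtx m))
    off-C m on = v'∉C (subst OnCycle αv≡v' (CF.absorbs C D m on i₀))

    d-on-C : OnCycle d → d ≡ v
    d-on-C on = ⊥-elim (off-C j on)

    v'≢d : v' ≢ d
    v'≢d e = j≢i₀ (sym (inj _ _ (fun-injective α (trans αv≡v' e))))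

    black-on-D : ∀ m → black d (fun α (vtx m)) ≡ true → m ≡ j
    black-on-D m b with black-true⁻ b
    ... | inj₁ e        = ⊥-elim (off-C m (i₀ , sym e))
    ... | inj₂ (inj₁ e) = ⊥-elim (off-C m (j , sym e))
    ... | inj₂ (inj₂ e) = inj _ _ (fun-injective α e)

    count-D : blackCount D ct ≡ 1
    count-D = trans (blackCount-inside in-domain? (black d) D (λ m → inj₂ (m , refl)))
                    (count-one _ _ j (black-true {d} (inj₂ (inj₂ refl))) black-on-D)

    fixes-D : ∀ (γ : Aut G) {c} → Extends c ct → (∀ y → c (fun γ y) ≡ c y) →
              fun γ v' ≡ v' → ∀ m → fun γ (fun α (vtx m)) ≡ fun α (vtx m)
    fixes-D γ {c} ext pres γv' = ᴰ.pin ⟨ γ ⟩ c pres i₀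
      (trans (cong (fun γ) αv≡v') (trans γv' (sym αv≡v')))
      (ᴰ.marked-neighbour c j-adjacent (trans (colour ext (inj₂ (j , refl))) (black-true {d} (inj₂ (inj₂ refl))))
        (λ m cm → inj₂ (black-on-D m (trans (sym (colour ext (inj₂ (m , refl)))) cm))))

    pinned : PinsDown G V' ct C D
    pinned γ fix (c , ext , pres) y (inj₁ y∈V') = fix y y∈V'
    pinned γ fix (c , ext , pres) y (inj₂ (inj₁ (m , refl))) =
      fixes-C d-on-C γ ext pres (proj₁ (fixes-v γ c (fix x x∈V') pres (v-v'-differ ext (inj₂ (i₀ , αv≡v')) v'≢d))) m
    pinned γ fix (c , ext , pres) y (inj₂ (inj₂ (m , refl))) =
      fixes-D γ ext pres (proj₂ (fixes-v γ c (fix x x∈V') pres (v-v'-differ ext (inj₂ (i₀ , αv≡v')) v'≢d))) m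

  witness : Witness G V' C
  witness with on-cycle? v'
  ... | yes v'∈C = on-C v'∈C
  ... | no v'∉C with vt v v'
  ...   | α , αv≡v' with any? (λ m → fun α (vtx m) ∈? V')
  ...     | yes αC∩V'  = meets α αv≡v' αC∩V'
  ...     | no αC∩V'=∅ = misses α αv≡v' v'∉C (λ m αm∈V' → αC∩V'=∅ (m , αm∈V'))

some-vertex : ∀ {n} (G : Graph n) → ¬ EdgeTransitive G → Fin n
some-vertex {zero}  G net = ⊥-elim (net (λ ()))
some-vertex {suc n} G net = Fin.zero

lemma3p6 : (n : ℕ) (G : Graph n) →
    Connected G → FourValent G → VertexTransitive G → ¬ EdgeTransitive G →
    AllEdgesType2 G →
    ExactlyTwoEdgeOrbits G ×
    (∀ (u₀ w₀ : Fin n) → Adj G u₀ w₀ →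
     ∀ (V' : Subset n) (C : Cycle (OrbitEdge G u₀ w₀)) →
     Cycle.DisjointFrom C V' →
     (∃[ i ] ∃[ x ] (x ∈ V' × Adj G (Cycle.vtx C i) x)) →
     Σ (Cycle (OrbitEdge G u₀ w₀)) λ D →
       Cycle.DisjointFrom D V' ×
       Σ (Fin n → Maybe Bool) λ ct →
         (∀ x → (ct x ≢ nothing → Cycle.OnCycle C x ⊎ Cycle.OnCycle D x) ×
                (Cycle.OnCycle C x ⊎ Cycle.OnCycle D x → ct x ≢ nothing)) ×
         (blackCount C ct ≡ 1 ⊎ blackCount C ct ≡ 2) ×
         (blackCount D ct ≡ 1 ⊎ blackCount D ct ≡ 2) ×
         (∀ (γ : Aut G) →
            (∀ x → x ∈ V' → fun γ x ≡ x) →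
            (Σ (Fin n → Bool) λ c → Extends c ct × (∀ x → c (fun {G = G} γ x) ≡ c x)) →
            ∀ x → (x ∈ V' ⊎ Cycle.OnCycle C x ⊎ Cycle.OnCycle D x) →
            fun γ x ≡ x))
lemma3p6 n G _ fv vt net t2 =
  two-edge-orbits (some-vertex G net) ,
  λ u₀ w₀ u₀w₀ V' C C∩V'=∅ (i₀ , x , x∈V' , v~x) →
    Construction.witness G vt orbit-graph-regular u₀w₀ V' C C∩V'=∅ i₀ x x∈V' v~x
  where open LocalStructure G fv vt net t2
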